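{- Let $G$ be a graph containing no subgraph isomorphic to $C_6$, let $x\in V(G)$, and let $(a,b,c)$ be a path (with $a,b,c$ distinct) in the induced subgraph $G[N_2(x)]$. Then there exists a vertex $v$ such that $\{v\}=N(x)\cap N(a)=N(x)\cap N(c)$.
   Context: Graphs are finite, simple, undirected. $N(v)$ is the set of neighbors of $v$; $N_2(x)$ is the set of vertices at distance exactly $2$ from $x$. "No subgraph isomorphic to $C_6$" refers to not necessarily induced subgraphs. -}

module Defs where

open import Data.Nat using (ℕ; suc)
open import Data.Fin using (Fin; zero; suc)
open import Data.Bool using (Bool; true)
open import Data.Product using (Σ; _×_; ∃; ∃-syntax)
open import Relation.Binary.PropositionalEquality using (_≡_)
open import Relation.Nullary using (¬_)
open import Function.Definitions using (Injective)

record Graph (n : ℕ) : Set where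
  field
    adj    : Fin n → Fin n → Bool
    sym    : ∀ u v → adj u v ≡ adj v u
    irrefl : ∀ v → ¬ (adj v v ≡ true)

open Graph public

Adj : ∀ {n} → Graph n → Fin n → Fin n → Set
Adj G u v = adj G u v ≡ true

next6 : Fin 6 → Fin 6
next6 zero = suc zero
next6 (suc zero) = suc (suc zero)
next6 (suc (suc zero)) = suc (suc (suc zero))
next6 (suc (suc (suc zero))) = suc (suc (suc (suc zero)))
next6 (suc (suc (suc (suc zero)))) = suc (suc (suc (suc (suc zero))))
next6 (suc (suc (suc (suc (suc zero))))) = zero

HasC6 : ∀ {n} → Graph n → Set
HasC6 {n} G = Σ (Fin 6 → Fin n) λ f → Injective _≡_ _≡_ f × (∀ i → Adj G (f i) (f (next6 i)))

Dist2 : ∀ {n} → Graph n → Fin n → Fin n → Set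
Dist2 G x v = ¬ (v ≡ x) × ¬ Adj G x v × ∃[ w ] (Adj G x w × Adj G w v)

module Submission where

-- Since a and c are at distance 2 from x, there are
-- common neighbours u ∈ N(x) ∩ N(a) and w ∈ N(x) ∩ N(c).  If u ≠ w, then
-- x u a b c w x is a closed walk on six pairwise distinct vertices (none of
-- a, b, c equals x or is adjacent to x, which separates them from x, u, w),
-- i.e. a copy of C₆.  Hence in a C₆-free graph every element of
-- N(x) ∩ N(a) coincides with every element of N(x) ∩ N(c), so both sets are
-- the same singleton.

open import Defs hiding (sym)
open import Data.Nat using (ℕ)
open import Data.Fin using (Fin; zero; suc)
open import Data.Fin.Properties using (_≟_)
open import Data.Vec using (Vec; []; _∷_; lookup)
open import Data.Vec.Relation.Unary.All using ([]; _∷_)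
open import Data.Vec.Relation.Unary.AllPairs using ([]; _∷_)
open import Data.Vec.Relation.Unary.Unique.Propositional using (Unique)
open import Data.Vec.Relation.Unary.Unique.Propositional.Properties using (lookup-injective)
open import Data.Product using (_×_; ∃-syntax; _,_)
open import Data.Empty using (⊥-elim)
open import Relation.Binary.PropositionalEquality using (_≡_; refl; sym; trans; subst)
open import Relation.Nullary using (¬_; yes; no)
open import Function.Bundles using (_⇔_; mk⇔)

module _ {n : ℕ} (G : Graph n) where

  adj-sym : ∀ {p q} → Adj G p q → Adj G q p
  adj-sym {p} {q} p~q = trans (Graph.sym G q p) p~q

  adj⇒≢ : ∀ {p q} → Adj G p q → ¬ (p ≡ q)
  adj⇒≢ {p} p~p refl = Graph.irrefl G p p~p

  Far : Fin n → Fin n → Set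
  Far x v = ¬ (v ≡ x) × ¬ Adj G x v

  dist2⇒far : ∀ {x v} → Dist2 G x v → Far x v
  dist2⇒far (v≢x , x≁v , _) = v≢x , x≁v

  neighbour≢far : ∀ {x u v} → Adj G x u → Far x v → ¬ (u ≡ v)
  neighbour≢far x~u (_ , x≁v) refl = x≁v x~u

  hexagon⇒HasC6 : (vs : Vec (Fin n) 6) → Unique vs →
    (∀ i → Adj G (lookup vs i) (lookup vs (next6 i))) → HasC6 G
  hexagon⇒HasC6 vs distinct edges =
    lookup vs , (λ {i} {j} → lookup-injective distinct i j) , edges

  -- The key step: for a path a – b – c of vertices far from x, a common
  -- neighbour u of x and a and a common neighbour w of x and c must coincide,
  -- since otherwise x u a b c w x is a hexagon.
  common-neighbours-coincide : ¬ HasC6 G → ∀ {x a b c u w} →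
    Far x a → Far x b → Far x c →
    ¬ (a ≡ b) → ¬ (b ≡ c) → ¬ (a ≡ c) → Adj G a b → Adj G b c →
    Adj G x u → Adj G u a → Adj G x w → Adj G w c → u ≡ w
  common-neighbours-coincide noC6 {x} {a} {b} {c} {u} {w}
    fa fb fc a≢b b≢c a≢c a~b b~c x~u u~a x~w w~c with u ≟ w
  ... | yes u≡w = u≡w
  ... | no u≢w = ⊥-elim (noC6 (hexagon⇒HasC6 (x ∷ u ∷ a ∷ b ∷ c ∷ w ∷ [])
                                              distinct edges))
    where
    far⇒≢x : ∀ {v} → Far x v → ¬ (x ≡ v)
    far⇒≢x (v≢x , _) x≡v = v≢x (sym x≡v)

    ≢w : ∀ {v} → Far x v → ¬ (v ≡ w)
    ≢w fv v≡w = neighbour≢far x~w fv (sym v≡w)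

    distinct : Unique (x ∷ u ∷ a ∷ b ∷ c ∷ w ∷ [])
    distinct =
        (adj⇒≢ x~u ∷ far⇒≢x fa ∷ far⇒≢x fb ∷ far⇒≢x fc ∷ adj⇒≢ x~w ∷ [])
      ∷ (adj⇒≢ u~a ∷ neighbour≢far x~u fb ∷ neighbour≢far x~u fc ∷ u≢w ∷ [])
      ∷ (a≢b ∷ a≢c ∷ ≢w fa ∷ [])
      ∷ (b≢c ∷ ≢w fb ∷ [])
      ∷ (adj⇒≢ (adj-sym w~c) ∷ [])
      ∷ [] ∷ []

    edges : ∀ i → Adj G (lookup (x ∷ u ∷ a ∷ b ∷ c ∷ w ∷ []) i)
                         (lookup (x ∷ u ∷ a ∷ b ∷ c ∷ w ∷ []) (next6 i))
    edges zero = x~u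
    edges (suc zero) = u~a
    edges (suc (suc zero)) = a~b
    edges (suc (suc (suc zero))) = b~c
    edges (suc (suc (suc (suc zero)))) = adj-sym w~c
    edges (suc (suc (suc (suc (suc zero))))) = adj-sym x~w

lemma1 : ∀ {n} (G : Graph n) → ¬ HasC6 G → (x a b c : Fin n) →
    Dist2 G x a → Dist2 G x b → Dist2 G x c →
    ¬ (a ≡ b) → ¬ (b ≡ c) → ¬ (a ≡ c) →
    Adj G a b → Adj G b c →
    ∃[ v ] ((∀ w → (Adj G x w × Adj G a w) ⇔ (w ≡ v)) ×
            (∀ w → (Adj G x w × Adj G c w) ⇔ (w ≡ v)))
lemma1 G noC6 x a b c da@(_ , _ , u , x~u , u~a) db dc@(_ , _ , w , x~w , w~c)
       a≢b b≢c a≢c a~b b~c =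
  u , (λ v → mk⇔ (λ (x~v , a~v) → trans (coincide x~v (adj-sym G a~v) x~w w~c) (sym u≡w))
                 (λ { refl → x~u , adj-sym G u~a }))
    , (λ v → mk⇔ (λ (x~v , c~v) → sym (coincide x~u u~a x~v (adj-sym G c~v)))
                 (λ { refl → x~u , subst (Adj G c) (sym u≡w) (adj-sym G w~c) }))
  where
  coincide : ∀ {u′ w′} → Adj G x u′ → Adj G u′ a → Adj G x w′ → Adj G w′ c → u′ ≡ w′
  coincide = common-neighbours-coincide G noC6
    (dist2⇒far G da) (dist2⇒far G db) (dist2⇒far G dc) a≢b b≢c a≢c a~b b~c

  u≡w : u ≡ w
  u≡w = coincide x~u u~a x~w w~c
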